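{- Let $a,i,c$ be integers with $a \ge 2$ and $c \ge 5$. Define $p = 2 - \frac{2}{c}$ and suppose $0 \le i \le p^c(p^{c-1}-2)$. If $a \le \frac{p^c}{c-1}$, then $\mathrm{dor}(a,a+i) \le c-1$.
   Context: For integers $1 \le a \le b$, an $(a,b)$-triple is a triple $(x, ax+d, bx+2d)$ with $x,d$ positive integers. A coloring admits a monochromatic $(a,b)$-triple if all three entries of some $(a,b)$-triple receive the same color. The pair $(a,b)$ is $r$-regular if every $r$-coloring of $\mathbb{N}$ admits a monochromatic $(a,b)$-triple. The degree of regularity $\mathrm{dor}(a,b)$ is the largest $r$ such that $(a,b)$ is $r$-regular, and $\mathrm{dor}(a,b)=\infty$ if $(a,b)$ is $r$-regular for all $r$. -}

module Defs where

open import Data.Nat using (ℕ; zero; suc; _+_; _*_; _≤_)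
open import Data.Fin using (Fin)
open import Data.Product using (_×_; ∃-syntax)
open import Relation.Binary.PropositionalEquality using (_≡_)
open import Data.Integer using (+_)
import Data.Rational as ℚ
open ℚ using (ℚ; _/_)

-- An r-colouring of ℕ (the colour of 0 is irrelevant: all entries of a triple are ≥ 1).
Colouring : ℕ → Set
Colouring r = ℕ → Fin r

MonoTriple : (r a b : ℕ) → Colouring r → Set
MonoTriple r a b χ =
  ∃[ x ] ∃[ d ] (1 ≤ x × 1 ≤ d ×
    χ x ≡ χ (a * x + d) × χ x ≡ χ (b * x + 2 * d))

Regular : (r a b : ℕ) → Set
Regular r a b = (χ : Colouring r) → MonoTriple r a b χ

-- dor(a,b) ≤ n : every r for which (a,b) is r-regular satisfies r ≤ n
-- (this also excludes dor(a,b) = ∞).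
DorAtMost : (a b n : ℕ) → Set
DorAtMost a b n = ∀ r → Regular r a b → r ≤ n

ℕ→ℚ : ℕ → ℚ
ℕ→ℚ n = (+ n) / 1

_^ℚ_ : ℚ → ℕ → ℚ
q ^ℚ zero = ℚ.1ℚ
q ^ℚ suc n = q ℚ.* (q ^ℚ n)

-- p = 2 - 2/c (the value at c = 0 is an irrelevant junk value; the theorem assumes c ≥ 5)
pOf : ℕ → ℚ
pOf zero = ℚ.0ℚ
pOf (suc k) = ℕ→ℚ 2 ℚ.- ((+ 2) / suc k)

{-# OPTIONS --safe #-}

-- Colour n by ⌊log_p n⌋ mod c, where p = 2 - 2/c. Suppose x, y = a x + d and z = (a + i) x + 2 d
-- share a colour. Since y ≥ 2 x ≥ p x, the colours force m = ⌊log_p y⌋ ≥ ⌊log_p x⌋ + c, so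
-- x < p^(m-c+1). Now z = 2 y + i x - a x. From a ≤ p^c / (c - 1) we get a x < (2/c) p^m, hence
-- z > 2 p^m - (2/c) p^m = p^(m+1); from i ≤ p^c (p^(c-1) - 2) we get z < 2 p^(m+1) + i p^(m-c+1)
-- ≤ p^(m+c). So m < ⌊log_p z⌋ < m + c, and z and y get different colours: (a, a + i) is not
-- c-regular.

module Submission where

open import Defs
open import Data.Nat
open import Data.Nat.Properties
open import Data.Nat.DivMod using (_%_; _mod_; m≡m%n+[m/n]*n; m%n<n)
open import Data.Nat.Tactic.RingSolver using (solve-∀)
open import Data.Fin using (toℕ; inject≤)
open import Data.Fin.Properties using (inject≤-injective; toℕ-fromℕ<)
open import Data.Product using (_×_; _,_; proj₁; proj₂; ∃-syntax)
open import Data.Empty using (⊥-elim)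
open import Relation.Nullary using (¬_; yes; no)
open import Relation.Unary using (Decidable)
open import Relation.Binary.PropositionalEquality
import Algebra.Properties.CommutativeSemigroup as CommutativeSemigroupProperties
open CommutativeSemigroupProperties *-commutativeSemigroup using (interchange; x∙yz≈y∙xz)
open import Data.Integer as ℤ using (+_)
import Data.Integer.Properties as ℤP
open import Data.Integer.Tactic.RingSolver as ℤ-Solver using ()
import Data.Rational as ℚ
import Data.Rational.Properties as ℚP
open import Data.Rational.Solver using (module +-*-Solver)
open import Data.Rational.Unnormalised as ℚᵘ using (mkℚᵘ; *≡*; *≤*)
import Data.Rational.Unnormalised.Properties as ℚᵘP
open import Algebra.Bundles using (CommutativeMonoid)

Regular-antimono : ∀ {r s a b} → r ≤ s → Regular s a b → Regular r a b
Regular-antimono r≤s reg χ with reg (λ n → inject≤ (χ n) r≤s)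
... | x , d , 1≤x , 1≤d , same₁ , same₂ =
  x , d , 1≤x , 1≤d , inject≤-injective r≤s r≤s _ _ same₁ , inject≤-injective r≤s r≤s _ _ same₂

¬Regular⇒DorAtMost : ∀ {a b n} → ¬ Regular (suc n) a b → DorAtMost a b n
¬Regular⇒DorAtMost {a} {b} {n} ¬reg r reg with r ≤? n
... | yes r≤n = r≤n
... | no r≰n = ⊥-elim (¬reg (Regular-antimono {a = a} {b} (≰⇒> r≰n) reg))

crossing : {P : ℕ → Set} → Decidable P → P 0 → ∀ K → ¬ P K → ∃[ k ] P k × ¬ P (suc k)
crossing P? P0 zero ¬PK = ⊥-elim (¬PK P0)
crossing P? P0 (suc K) ¬PK with P? K
... | yes PK = K , PK , ¬PK
... | no ¬PK′ = crossing P? P0 K ¬PK′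

%-≡⇒+-≤ : ∀ {m m′} n .{{_ : NonZero n}} → m % n ≡ m′ % n → m < m′ → m + n ≤ m′
%-≡⇒+-≤ {m} {m′} n r≡r′ m<m′ = begin
  m + n                     ≡⟨ cong (_+ n) (m≡m%n+[m/n]*n m n) ⟩
  m % n + m / n * n + n     ≡⟨ +-assoc (m % n) (m / n * n) n ⟩
  m % n + (m / n * n + n)   ≡⟨ cong (λ w → m % n + w) (+-comm (m / n * n) n) ⟩
  m % n + suc (m / n) * n   ≤⟨ +-monoʳ-≤ (m % n) (*-monoˡ-≤ n q<q′) ⟩
  m % n + m′ / n * n        ≡⟨ cong (_+ m′ / n * n) r≡r′ ⟩
  m′ % n + m′ / n * n       ≡⟨ m≡m%n+[m/n]*n m′ n ⟨
  m′ ∎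
  where
  open ≤-Reasoning
  q<q′ : m / n < m′ / n
  q<q′ = *-cancelʳ-< n (m / n) (m′ / n) (+-cancelˡ-< (m % n) _ _ (begin-strict
    m % n + m / n * n    ≡⟨ m≡m%n+[m/n]*n m n ⟨
    m                    <⟨ m<m′ ⟩
    m′                   ≡⟨ m≡m%n+[m/n]*n m′ n ⟩
    m′ % n + m′ / n * n  ≡⟨ cong (_+ m′ / n * n) r≡r′ ⟨
    m % n + m′ / n * n   ∎))

mod-≡⇒+-≤ : ∀ {m m′} n .{{_ : NonZero n}} → m mod n ≡ m′ mod n → m < m′ → m + n ≤ m′
mod-≡⇒+-≤ {m} {m′} n same = %-≡⇒+-≤ n (begin
  m % n                      ≡⟨ toℕ-fromℕ< (m%n<n m n) ⟨
  toℕ (m mod n)              ≡⟨ cong toℕ same ⟩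
  toℕ (m′ mod n)             ≡⟨ toℕ-fromℕ< (m%n<n m′ n) ⟩
  m′ % n ∎)
  where open ≡-Reasoning

^-distribˡ-+-suc : ∀ b t c → b ^ suc (t + c) ≡ b ^ t * b ^ suc c
^-distribˡ-+-suc b t c = trans (cong (b ^_) (sym (+-suc t c))) (^-distribˡ-+-* b t (suc c))

2x≤ax+d : ∀ a x d → 2 ≤ a → 2 * x ≤ a * x + d
2x≤ax+d a x d 2≤a = ≤-trans (*-monoˡ-≤ x 2≤a) (m≤m+n (a * x) d)

bernoulli : ∀ c k → c ^ k * (c + k) ≤ suc c ^ k * c
bernoulli c zero = ≤-reflexive (cong (_+ 0) (+-identityʳ c))
bernoulli c (suc k) = begin
  c * c ^ k * (c + suc k)                 ≡⟨ expand c (c ^ k) k ⟩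
  c * (c ^ k * (c + k)) + c ^ k * c       ≤⟨ +-monoʳ-≤ _ (*-monoʳ-≤ (c ^ k) (m≤m+n c k)) ⟩
  c * (c ^ k * (c + k)) + c ^ k * (c + k) ≡⟨ +-comm _ (c ^ k * (c + k)) ⟩
  suc c * (c ^ k * (c + k))               ≤⟨ *-monoʳ-≤ (suc c) (bernoulli c k) ⟩
  suc c * (suc c ^ k * c)                 ≡⟨ *-assoc (suc c) (suc c ^ k) c ⟨
  suc c * suc c ^ k * c ∎
  where
  open ≤-Reasoning
  expand : ∀ c p k → c * p * (c + suc k) ≡ c * (p * (c + k)) + p * c
  expand = solve-∀

-- ⌊log_p n⌋ for p = Q/C

module FloorLog (C Q : ℕ) .{{_ : NonZero C}} (C<Q : C < Q) where

  infix 4 _≥p^_ _<p^_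

  _≥p^_ _<p^_ : ℕ → ℕ → Set
  n ≥p^ j = Q ^ j ≤ n * C ^ j
  n <p^ j = n * C ^ j < Q ^ j

  <p^-suc : ∀ n j → n <p^ j → n <p^ suc j
  <p^-suc n j n<p^j = begin-strict
    n * (C * C ^ j)  ≡⟨ x∙yz≈y∙xz n C (C ^ j) ⟩
    C * (n * C ^ j)  <⟨ *-monoʳ-< C n<p^j ⟩
    C * Q ^ j        ≤⟨ *-monoˡ-≤ (Q ^ j) (<⇒≤ C<Q) ⟩
    Q * Q ^ j ∎
    where
    open ≤-Reasoning

  <p^-mono : ∀ n {j j′} → j ≤ j′ → n <p^ j → n <p^ j′
  <p^-mono n j≤j′ = go (≤⇒≤′ j≤j′)
    where
    go : ∀ {j j′} → j ≤′ j′ → n <p^ j → n <p^ j′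
    go ≤′-refl n<p^j = n<p^j
    go {j′ = suc j′} (≤′-step j≤j′) n<p^j = <p^-suc n j′ (go j≤j′ n<p^j)

  <p^-unbounded : ∀ n → n <p^ n * C
  <p^-unbounded n = <-≤-trans (*-cancelʳ-< C _ _ (begin-strict
    n * C ^ K * C            <⟨ m<n+m _ (*-mono-≤ (m^n>0 C K) (>-nonZero⁻¹ C)) ⟩
    C ^ K * C + n * C ^ K * C ≡⟨ factor (C ^ K) C n ⟩
    C ^ K * (C + K)          ≤⟨ bernoulli C K ⟩
    suc C ^ K * C ∎)) (^-monoˡ-≤ K C<Q)
    where
    open ≤-Reasoning
    K = n * C
    factor : ∀ P C n → P * C + n * P * C ≡ P * (C + n * C)
    factor = solve-∀

  ⌊log⌋-exists : ∀ n → 1 ≤ n → ∃[ k ] n ≥p^ k × n <p^ suc k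
  ⌊log⌋-exists n 1≤n with crossing (λ k → Q ^ k ≤? n * C ^ k)
                            (≤-trans 1≤n (≤-reflexive (sym (*-identityʳ n))))
                            (n * C) (<⇒≱ (<p^-unbounded n))
  ... | k , n≥p^k , n≱p^k+1 = k , n≥p^k , ≰⇒> n≱p^k+1

  ⌊log⌋ : ℕ → ℕ
  ⌊log⌋ zero = 0
  ⌊log⌋ n@(suc _) = proj₁ (⌊log⌋-exists n (s≤s z≤n))

  ⌊log⌋-spec : ∀ {n} → 1 ≤ n → n ≥p^ ⌊log⌋ n × n <p^ suc (⌊log⌋ n)
  ⌊log⌋-spec {n@(suc _)} _ = proj₂ (⌊log⌋-exists n (s≤s z≤n))

  ≥p^⇒≤⌊log⌋ : ∀ {n j} → 1 ≤ n → n ≥p^ j → j ≤ ⌊log⌋ n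
  ≥p^⇒≤⌊log⌋ {n} 1≤n n≥p^j = ≮⇒≥ λ ⌊log⌋<j →
    <⇒≱ (<p^-mono n ⌊log⌋<j (proj₂ (⌊log⌋-spec 1≤n))) n≥p^j

  <p^⇒⌊log⌋< : ∀ {n j} → 1 ≤ n → n <p^ j → ⌊log⌋ n < j
  <p^⇒⌊log⌋< {n} 1≤n n<p^j = ≰⇒> λ j≤⌊log⌋ →
    <⇒≱ (<p^-mono n j≤⌊log⌋ n<p^j) (proj₁ (⌊log⌋-spec 1≤n))

-- The colouring n ↦ ⌊log_p n⌋ mod c for p = 2 - 2/c, with c = suc c′

module LogColouring (c′ : ℕ) (2≤c′ : 2 ≤ c′) where

  C Q : ℕ
  C = suc c′
  Q = 2 * c′

  C<Q : C < Q
  C<Q = ≤-trans (+-monoˡ-≤ c′ 2≤c′) (≤-reflexive (cong (λ w → c′ + w) (sym (+-identityʳ c′))))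

  Q≤2C : Q ≤ 2 * C
  Q≤2C = *-monoʳ-≤ 2 (n≤1+n c′)

  Q+2≡2C : Q + 2 ≡ 2 * C
  Q+2≡2C = shift c′
    where
    shift : ∀ c → 2 * c + 2 ≡ 2 * (1 + c)
    shift = solve-∀

  open FloorLog C Q C<Q public

  colour : Colouring C
  colour n = ⌊log⌋ n mod C

  ⌊log⌋-double : ∀ {x y} → 1 ≤ x → 2 * x ≤ y → ⌊log⌋ x < ⌊log⌋ y
  ⌊log⌋-double {x} {y} 1≤x 2x≤y = ≥p^⇒≤⌊log⌋ 1≤y (begin
    Q * Q ^ k            ≤⟨ *-monoʳ-≤ Q (proj₁ (⌊log⌋-spec 1≤x)) ⟩
    Q * (x * C ^ k)      ≤⟨ *-monoˡ-≤ (x * C ^ k) Q≤2C ⟩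
    2 * C * (x * C ^ k)  ≡⟨ interchange 2 C x (C ^ k) ⟩
    2 * x * (C * C ^ k)  ≤⟨ *-monoˡ-≤ (C * C ^ k) 2x≤y ⟩
    y * (C * C ^ k) ∎)
    where
    open ≤-Reasoning
    k = ⌊log⌋ x
    1≤y = ≤-trans 1≤x (≤-trans (m≤m+n x (x + 0)) 2x≤y)

  ax≤2Q^m : ∀ a x t → a * C ^ C ≤ 2 * Q ^ c′ → x * C ^ t ≤ Q ^ t →
            a * x * C ^ suc (t + c′) ≤ 2 * Q ^ (t + c′)
  ax≤2Q^m a x t a-bound x≤p^t = begin
    a * x * C ^ suc (t + c′)  ≡⟨ cong (a * x *_) (^-distribˡ-+-suc C t c′) ⟩
    a * x * (C ^ t * C ^ C)   ≡⟨ regroup a x (C ^ t) (C ^ C) ⟩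
    a * C ^ C * (x * C ^ t)   ≤⟨ *-mono-≤ a-bound x≤p^t ⟩
    2 * Q ^ c′ * Q ^ t        ≡⟨ regroup′ (Q ^ c′) (Q ^ t) ⟩
    2 * (Q ^ t * Q ^ c′)      ≡⟨ cong (2 *_) (^-distribˡ-+-* Q t c′) ⟨
    2 * Q ^ (t + c′) ∎
    where
    open ≤-Reasoning
    regroup : ∀ a x P R → a * x * (P * R) ≡ a * R * (x * P)
    regroup = solve-∀
    regroup′ : ∀ R P → 2 * R * P ≡ 2 * (P * R)
    regroup′ = solve-∀

  lower-bound : ∀ a i x y z m → y ≥p^ m → a * x * C ^ suc m ≤ 2 * Q ^ m →
                z + a * x ≡ 2 * y + i * x → z ≥p^ suc m
  lower-bound a i x y z m y≥p^m ax≤2Q^m z+ax≡ = +-cancelʳ-≤ (a * x * C ^ suc m) _ _ (begin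
    Q * Q ^ m + a * x * C ^ suc m      ≤⟨ +-monoʳ-≤ (Q * Q ^ m) ax≤2Q^m ⟩
    Q * Q ^ m + 2 * Q ^ m              ≡⟨ *-distribʳ-+ (Q ^ m) Q 2 ⟨
    (Q + 2) * Q ^ m                    ≡⟨ cong (_* Q ^ m) Q+2≡2C ⟩
    2 * C * Q ^ m                      ≤⟨ *-monoʳ-≤ (2 * C) y≥p^m ⟩
    2 * C * (y * C ^ m)                ≡⟨ interchange 2 C y (C ^ m) ⟩
    2 * y * C ^ suc m                  ≤⟨ *-monoˡ-≤ (C ^ suc m) (m≤m+n (2 * y) (i * x)) ⟩
    (2 * y + i * x) * C ^ suc m        ≡⟨ cong (_* C ^ suc m) z+ax≡ ⟨
    (z + a * x) * C ^ suc m            ≡⟨ *-distribʳ-+ (C ^ suc m) z (a * x) ⟩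
    z * C ^ suc m + a * x * C ^ suc m  ∎)
    where open ≤-Reasoning

  upper-bound : ∀ a i x y z t →
    i * C ^ C * C ^ c′ + 2 * Q ^ C * C ^ c′ ≤ Q ^ C * Q ^ c′ →
    x * C ^ t ≤ Q ^ t → y <p^ suc (t + c′) → z + a * x ≡ 2 * y + i * x →
    z <p^ suc (t + c′) + c′
  upper-bound a i x y z t i-bound x≤p^t y<p^m+1 z+ax≡ = begin-strict
    z * C ^ (suc (t + c′) + c′)                  ≡⟨ cong (z *_) (split C) ⟩
    z * (Ct * CC * Cc)                           ≤⟨ *-monoˡ-≤ (Ct * CC * Cc) (m≤m+n z (a * x)) ⟩
    (z + a * x) * (Ct * CC * Cc)                 ≡⟨ cong (_* (Ct * CC * Cc)) z+ax≡ ⟩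
    (2 * y + i * x) * (Ct * CC * Cc)             ≡⟨ expand y i x Ct CC Cc ⟩
    2 * Cc * (y * (Ct * CC)) + i * CC * Cc * (x * Ct)
      <⟨ +-mono-<-≤ (*-monoʳ-< (2 * Cc) {{m*n≢0 2 Cc {{_}} {{m^n≢0 C c′}}}} y<p^m+1′)
                    (*-monoʳ-≤ (i * CC * Cc) x≤p^t) ⟩
    2 * Cc * (Qt * QC) + i * CC * Cc * Qt        ≡⟨ collect Cc Qt QC (i * CC * Cc) ⟩
    Qt * (i * CC * Cc + 2 * QC * Cc)             ≤⟨ *-monoʳ-≤ Qt i-bound ⟩
    Qt * (QC * Q ^ c′)                           ≡⟨ *-assoc Qt QC (Q ^ c′) ⟨
    Qt * QC * Q ^ c′                             ≡⟨ split Q ⟨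
    Q ^ (suc (t + c′) + c′) ∎
    where
    open ≤-Reasoning
    Ct = C ^ t
    CC = C ^ C
    Cc = C ^ c′
    Qt = Q ^ t
    QC = Q ^ C
    split : ∀ b → b ^ (suc (t + c′) + c′) ≡ b ^ t * b ^ C * b ^ c′
    split b = trans (^-distribˡ-+-* b (suc (t + c′)) c′) (cong (_* b ^ c′) (^-distribˡ-+-suc b t c′))
    y<p^m+1′ : y * (Ct * CC) < Qt * QC
    y<p^m+1′ = subst₂ (λ P R → y * P < R) (^-distribˡ-+-suc C t c′) (^-distribˡ-+-suc Q t c′) y<p^m+1
    expand : ∀ y i x Ct CC Cc → (2 * y + i * x) * (Ct * CC * Cc) ≡ 2 * Cc * (y * (Ct * CC)) + i * CC * Cc * (x * Ct)
    expand = solve-∀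
    collect : ∀ Cc Qt QC I → 2 * Cc * (Qt * QC) + I * Qt ≡ Qt * (I + 2 * QC * Cc)
    collect = solve-∀

  ⌊log⌋-window : ∀ a i x d → 2 ≤ a → a * C ^ C ≤ 2 * Q ^ c′ →
    i * C ^ C * C ^ c′ + 2 * Q ^ C * C ^ c′ ≤ Q ^ C * Q ^ c′ → 1 ≤ x →
    ⌊log⌋ x + C ≤ ⌊log⌋ (a * x + d) →
    let m = ⌊log⌋ (a * x + d) ; n = ⌊log⌋ ((a + i) * x + 2 * d) in m < n × n < m + C
  ⌊log⌋-window a i x d 2≤a a-bound i-bound 1≤x k+C≤m = m<⌊log⌋z , ⌊log⌋z<m+C
    where
    y = a * x + d
    z = (a + i) * x + 2 * d
    k = ⌊log⌋ x
    m = ⌊log⌋ y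
    z+ax≡ : z + a * x ≡ 2 * y + i * x
    z+ax≡ = rearrange a i x d
      where
      rearrange : ∀ a i x d → (a + i) * x + 2 * d + a * x ≡ 2 * (a * x + d) + i * x
      rearrange = solve-∀
    1≤y : 1 ≤ y
    1≤y = ≤-trans 1≤x (≤-trans (m≤m+n x (x + 0)) (2x≤ax+d a x d 2≤a))
    1≤z : 1 ≤ z
    1≤z = ≤-trans 1≤y (+-mono-≤ (*-monoˡ-≤ x (m≤m+n a i)) (m≤m+n d (d + 0)))
    t = m ∸ c′
    t+c′≡m : t + c′ ≡ m
    t+c′≡m = m∸n+n≡m (≤-trans (≤-trans (n≤1+n c′) (m≤n+m C k)) k+C≤m)
    k<t : k < t
    k<t = +-cancelʳ-≤ c′ (suc k) t (subst (suc k + c′ ≤_) (sym t+c′≡m)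
            (subst (_≤ m) (+-suc k c′) k+C≤m))
    x≤p^t : x * C ^ t ≤ Q ^ t
    x≤p^t = <⇒≤ (<p^-mono x k<t (proj₂ (⌊log⌋-spec 1≤x)))
    y-spec : y ≥p^ (t + c′) × y <p^ suc (t + c′)
    y-spec = subst (λ e → y ≥p^ e × y <p^ suc e) (sym t+c′≡m) (⌊log⌋-spec 1≤y)
    m<⌊log⌋z : m < ⌊log⌋ z
    m<⌊log⌋z = subst (_< ⌊log⌋ z) t+c′≡m (≥p^⇒≤⌊log⌋ 1≤z
      (lower-bound a i x y z (t + c′) (proj₁ y-spec) (ax≤2Q^m a x t a-bound x≤p^t) z+ax≡))
    ⌊log⌋z<m+C : ⌊log⌋ z < m + C
    ⌊log⌋z<m+C = subst (⌊log⌋ z <_) (trans (sym (+-suc (t + c′) c′)) (cong (_+ C) t+c′≡m))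
      (<p^⇒⌊log⌋< 1≤z (upper-bound a i x y z t i-bound x≤p^t (proj₂ y-spec) z+ax≡))

  no-monochromatic-triple : ∀ a i → 2 ≤ a → a * C ^ C ≤ 2 * Q ^ c′ →
    i * C ^ C * C ^ c′ + 2 * Q ^ C * C ^ c′ ≤ Q ^ C * Q ^ c′ →
    ¬ MonoTriple C a (a + i) colour
  no-monochromatic-triple a i 2≤a a-bound i-bound (x , d , 1≤x , _ , same₁ , same₂) =
    <⇒≱ (proj₂ window) (mod-≡⇒+-≤ C (trans (sym same₁) same₂) (proj₁ window))
    where
    window = ⌊log⌋-window a i x d 2≤a a-bound i-bound 1≤x
               (mod-≡⇒+-≤ C same₁ (⌊log⌋-double 1≤x (2x≤ax+d a x d 2≤a)))

-- Clearing denominators in the hypotheses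

toℚᵘ-ℕ→ℚ : ∀ n → ℚ.toℚᵘ (ℕ→ℚ n) ℚᵘ.≃ mkℚᵘ (+ n) 0
toℚᵘ-ℕ→ℚ n = ℚP.toℚᵘ-fromℚᵘ (mkℚᵘ (+ n) 0)

ℕ→ℚ-+ : ∀ m n → ℕ→ℚ (m + n) ≡ ℕ→ℚ m ℚ.+ ℕ→ℚ n
ℕ→ℚ-+ m n = ℚP.toℚᵘ-injective (begin
  ℚ.toℚᵘ (ℕ→ℚ (m + n))                  ≈⟨ toℚᵘ-ℕ→ℚ (m + n) ⟩
  mkℚᵘ (+ (m + n)) 0                    ≈⟨ *≡* (cong (ℤ._* + 1) (trans (ℤP.pos-+ m n)
                                             (sym (cong₂ ℤ._+_ (ℤP.*-identityʳ (+ m)) (ℤP.*-identityʳ (+ n)))))) ⟩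
  mkℚᵘ (+ m) 0 ℚᵘ.+ mkℚᵘ (+ n) 0        ≈⟨ ℚᵘP.+-cong (toℚᵘ-ℕ→ℚ m) (toℚᵘ-ℕ→ℚ n) ⟨
  ℚ.toℚᵘ (ℕ→ℚ m) ℚᵘ.+ ℚ.toℚᵘ (ℕ→ℚ n)    ≈⟨ ℚP.toℚᵘ-homo-+ (ℕ→ℚ m) (ℕ→ℚ n) ⟨
  ℚ.toℚᵘ (ℕ→ℚ m ℚ.+ ℕ→ℚ n) ∎)
  where open ℚᵘP.≃-Reasoning

ℕ→ℚ-* : ∀ m n → ℕ→ℚ (m * n) ≡ ℕ→ℚ m ℚ.* ℕ→ℚ n
ℕ→ℚ-* m n = ℚP.toℚᵘ-injective (begin
  ℚ.toℚᵘ (ℕ→ℚ (m * n))                  ≈⟨ toℚᵘ-ℕ→ℚ (m * n) ⟩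
  mkℚᵘ (+ (m * n)) 0                    ≈⟨ *≡* (cong (ℤ._* + 1) (ℤP.pos-* m n)) ⟩
  mkℚᵘ (+ m) 0 ℚᵘ.* mkℚᵘ (+ n) 0        ≈⟨ ℚᵘP.*-cong (toℚᵘ-ℕ→ℚ m) (toℚᵘ-ℕ→ℚ n) ⟨
  ℚ.toℚᵘ (ℕ→ℚ m) ℚᵘ.* ℚ.toℚᵘ (ℕ→ℚ n)    ≈⟨ ℚP.toℚᵘ-homo-* (ℕ→ℚ m) (ℕ→ℚ n) ⟨
  ℚ.toℚᵘ (ℕ→ℚ m ℚ.* ℕ→ℚ n) ∎)
  where open ℚᵘP.≃-Reasoning

ℕ→ℚ-*₃ : ∀ m n o → ℕ→ℚ (m * n * o) ≡ ℕ→ℚ m ℚ.* ℕ→ℚ n ℚ.* ℕ→ℚ o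
ℕ→ℚ-*₃ m n o = trans (ℕ→ℚ-* (m * n) o) (cong (ℚ._* ℕ→ℚ o) (ℕ→ℚ-* m n))

ℕ→ℚ-^ : ∀ m n → ℕ→ℚ (m ^ n) ≡ ℕ→ℚ m ^ℚ n
ℕ→ℚ-^ m zero = refl
ℕ→ℚ-^ m (suc n) = trans (ℕ→ℚ-* m (m ^ n)) (cong (ℕ→ℚ m ℚ.*_) (ℕ→ℚ-^ m n))

ℕ→ℚ-cancel-≤ : ∀ {m n} → ℕ→ℚ m ℚ.≤ ℕ→ℚ n → m ≤ n
ℕ→ℚ-cancel-≤ {m} {n} le
  with ℚᵘP.≤-respʳ-≃ (toℚᵘ-ℕ→ℚ n) (ℚᵘP.≤-respˡ-≃ (toℚᵘ-ℕ→ℚ m) (ℚP.toℚᵘ-mono-≤ le))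
... | *≤* le′ = ℤP.drop‿+≤+ (subst₂ ℤ._≤_ (ℤP.*-identityʳ (+ m)) (ℤP.*-identityʳ (+ n)) le′)

ℕ→ℚ-nonNeg : ∀ n → ℚ.NonNegative (ℕ→ℚ n)
ℕ→ℚ-nonNeg n = ℚP.normalize-nonNeg n 1

^ℚ-distrib-* : ∀ p q n → (p ℚ.* q) ^ℚ n ≡ p ^ℚ n ℚ.* q ^ℚ n
^ℚ-distrib-* p q zero = refl
^ℚ-distrib-* p q (suc n) =
  trans (cong ((p ℚ.* q) ℚ.*_) (^ℚ-distrib-* p q n)) (ℚ*.interchange p q (p ^ℚ n) (q ^ℚ n))
  where
  module ℚ* = CommutativeSemigroupProperties
                (CommutativeMonoid.commutativeSemigroup ℚP.*-1-commutativeMonoid)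

pOf-*-ℕ→ℚ : ∀ c′ → pOf (suc c′) ℚ.* ℕ→ℚ (suc c′) ≡ ℕ→ℚ (2 * c′)
pOf-*-ℕ→ℚ c′ = ℚP.toℚᵘ-injective (begin
  ℚ.toℚᵘ (pOf (suc c′) ℚ.* ℕ→ℚ (suc c′))
    ≈⟨ ℚP.toℚᵘ-homo-* (pOf (suc c′)) (ℕ→ℚ (suc c′)) ⟩
  ℚ.toℚᵘ (pOf (suc c′)) ℚᵘ.* ℚ.toℚᵘ (ℕ→ℚ (suc c′))
    ≈⟨ ℚᵘP.*-cong toℚᵘ-pOf (toℚᵘ-ℕ→ℚ (suc c′)) ⟩
  (mkℚᵘ (+ 2) 0 ℚᵘ.- mkℚᵘ (+ 2) c′) ℚᵘ.* mkℚᵘ (+ suc c′) 0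
    ≈⟨ *≡* (trans (cross-multiplied (+ c′)) (cong (ℤ._* ((+ 1 ℤ.* + suc c′) ℤ.* + 1)) (sym (ℤP.pos-* 2 c′)))) ⟩
  mkℚᵘ (+ (2 * c′)) 0
    ≈⟨ toℚᵘ-ℕ→ℚ (2 * c′) ⟨
  ℚ.toℚᵘ (ℕ→ℚ (2 * c′)) ∎)
  where
  open ℚᵘP.≃-Reasoning
  toℚᵘ-pOf : ℚ.toℚᵘ (pOf (suc c′)) ℚᵘ.≃ mkℚᵘ (+ 2) 0 ℚᵘ.- mkℚᵘ (+ 2) c′
  toℚᵘ-pOf = ℚᵘP.≃-trans (ℚP.toℚᵘ-homo-+ (ℕ→ℚ 2) (ℚ.- (+ 2 ℚ./ suc c′)))
    (ℚᵘP.+-cong (toℚᵘ-ℕ→ℚ 2) (ℚᵘP.≃-trans (ℚP.toℚᵘ-homo‿- (+ 2 ℚ./ suc c′))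
                                          (ℚᵘP.-‿cong (ℚP.toℚᵘ-fromℚᵘ (mkℚᵘ (+ 2) c′)))))
  cross-multiplied : ∀ x → ((+ 2 ℤ.* (+ 1 ℤ.+ x) ℤ.+ ℤ.- + 2 ℤ.* + 1) ℤ.* (+ 1 ℤ.+ x)) ℤ.* + 1
                           ≡ + 2 ℤ.* x ℤ.* ((+ 1 ℤ.* (+ 1 ℤ.+ x)) ℤ.* + 1)
  cross-multiplied = ℤ-Solver.solve-∀

pOf^-*-ℕ→ℚ : ∀ c′ n → pOf (suc c′) ^ℚ n ℚ.* ℕ→ℚ (suc c′ ^ n) ≡ ℕ→ℚ ((2 * c′) ^ n)
pOf^-*-ℕ→ℚ c′ n = begin
  pOf (suc c′) ^ℚ n ℚ.* ℕ→ℚ (suc c′ ^ n)       ≡⟨ cong (pOf (suc c′) ^ℚ n ℚ.*_) (ℕ→ℚ-^ (suc c′) n) ⟩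
  pOf (suc c′) ^ℚ n ℚ.* ℕ→ℚ (suc c′) ^ℚ n      ≡⟨ ^ℚ-distrib-* (pOf (suc c′)) (ℕ→ℚ (suc c′)) n ⟨
  (pOf (suc c′) ℚ.* ℕ→ℚ (suc c′)) ^ℚ n         ≡⟨ cong (_^ℚ n) (pOf-*-ℕ→ℚ c′) ⟩
  ℕ→ℚ (2 * c′) ^ℚ n                            ≡⟨ ℕ→ℚ-^ (2 * c′) n ⟨
  ℕ→ℚ ((2 * c′) ^ n) ∎
  where open ≡-Reasoning

a-bound-cleared : ∀ a c′ .{{_ : NonZero c′}} →
  ℕ→ℚ a ℚ.* ℕ→ℚ c′ ℚ.≤ pOf (suc c′) ^ℚ suc c′ →
  a * suc c′ ^ suc c′ ≤ 2 * (2 * c′) ^ c′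
a-bound-cleared a c′ a-bound = *-cancelˡ-≤ c′ (ℕ→ℚ-cancel-≤ (begin
  ℕ→ℚ (c′ * (a * C ^ C))                  ≡⟨ cong ℕ→ℚ (x∙yz≈y∙xz c′ a (C ^ C)) ⟩
  ℕ→ℚ (a * (c′ * C ^ C))                  ≡⟨ cong ℕ→ℚ (*-assoc a c′ (C ^ C)) ⟨
  ℕ→ℚ (a * c′ * C ^ C)                    ≡⟨ ℕ→ℚ-*₃ a c′ (C ^ C) ⟩
  ℕ→ℚ a ℚ.* ℕ→ℚ c′ ℚ.* ℕ→ℚ (C ^ C)        ≤⟨ ℚP.*-monoʳ-≤-nonNeg (ℕ→ℚ (C ^ C)) {{ℕ→ℚ-nonNeg (C ^ C)}} a-bound ⟩
  pOf C ^ℚ C ℚ.* ℕ→ℚ (C ^ C)               ≡⟨ pOf^-*-ℕ→ℚ c′ C ⟩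
  ℕ→ℚ (2 * c′ * Q ^ c′)                  ≡⟨ cong ℕ→ℚ (trans (*-assoc 2 c′ (Q ^ c′)) (x∙yz≈y∙xz 2 c′ (Q ^ c′))) ⟩
  ℕ→ℚ (c′ * (2 * Q ^ c′)) ∎))
  where
  open ℚP.≤-Reasoning
  C = suc c′
  Q = 2 * c′

i-bound-cleared : ∀ i c′ →
  ℕ→ℚ i ℚ.≤ (pOf (suc c′) ^ℚ suc c′) ℚ.* ((pOf (suc c′) ^ℚ c′) ℚ.- ℕ→ℚ 2) →
  i * suc c′ ^ suc c′ * suc c′ ^ c′ + 2 * (2 * c′) ^ suc c′ * suc c′ ^ c′
    ≤ (2 * c′) ^ suc c′ * (2 * c′) ^ c′
i-bound-cleared i c′ i-bound = ℕ→ℚ-cancel-≤ (begin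
  ℕ→ℚ (i * CC * Cc + 2 * QC * Cc)
    ≡⟨ trans (ℕ→ℚ-+ (i * CC * Cc) (2 * QC * Cc)) (cong₂ ℚ._+_ (ℕ→ℚ-*₃ i CC Cc) (ℕ→ℚ-*₃ 2 QC Cc)) ⟩
  ℕ→ℚ i ℚ.* ℕ→ℚ CC ℚ.* ℕ→ℚ Cc ℚ.+ ℕ→ℚ 2 ℚ.* ℕ→ℚ QC ℚ.* ℕ→ℚ Cc
    ≤⟨ ℚP.+-monoˡ-≤ (ℕ→ℚ 2 ℚ.* ℕ→ℚ QC ℚ.* ℕ→ℚ Cc)
         (ℚP.*-monoʳ-≤-nonNeg (ℕ→ℚ Cc) {{ℕ→ℚ-nonNeg Cc}}
           (ℚP.*-monoʳ-≤-nonNeg (ℕ→ℚ CC) {{ℕ→ℚ-nonNeg CC}} i-bound)) ⟩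
  P ℚ.* (R ℚ.- ℕ→ℚ 2) ℚ.* ℕ→ℚ CC ℚ.* ℕ→ℚ Cc ℚ.+ ℕ→ℚ 2 ℚ.* ℕ→ℚ QC ℚ.* ℕ→ℚ Cc
    ≡⟨ cong (λ w → P ℚ.* (R ℚ.- ℕ→ℚ 2) ℚ.* ℕ→ℚ CC ℚ.* ℕ→ℚ Cc ℚ.+ ℕ→ℚ 2 ℚ.* w ℚ.* ℕ→ℚ Cc)
            (pOf^-*-ℕ→ℚ c′ C) ⟨
  P ℚ.* (R ℚ.- ℕ→ℚ 2) ℚ.* ℕ→ℚ CC ℚ.* ℕ→ℚ Cc ℚ.+ ℕ→ℚ 2 ℚ.* (P ℚ.* ℕ→ℚ CC) ℚ.* ℕ→ℚ Cc
    ≡⟨ add-back P R (ℕ→ℚ 2) (ℕ→ℚ CC) (ℕ→ℚ Cc) ⟩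
  P ℚ.* ℕ→ℚ CC ℚ.* (R ℚ.* ℕ→ℚ Cc)
    ≡⟨ cong₂ ℚ._*_ (pOf^-*-ℕ→ℚ c′ C) (pOf^-*-ℕ→ℚ c′ c′) ⟩
  ℕ→ℚ QC ℚ.* ℕ→ℚ (Q ^ c′)
    ≡⟨ ℕ→ℚ-* QC (Q ^ c′) ⟨
  ℕ→ℚ (QC * Q ^ c′) ∎)
  where
  open ℚP.≤-Reasoning
  open +-*-Solver
  C = suc c′
  Q = 2 * c′
  CC = C ^ C
  Cc = C ^ c′
  QC = Q ^ C
  P = pOf C ^ℚ C
  R = pOf C ^ℚ c′
  add-back : ∀ P R T X Y → P ℚ.* (R ℚ.- T) ℚ.* X ℚ.* Y ℚ.+ T ℚ.* (P ℚ.* X) ℚ.* Y ≡ P ℚ.* X ℚ.* (R ℚ.* Y)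
  add-back = solve 5 (λ P R T X Y → P :* (R :- T) :* X :* Y :+ T :* (P :* X) :* Y := P :* X :* (R :* Y)) refl

theorem2 : (a i c : ℕ) → 2 ≤ a → 5 ≤ c →
    ℕ→ℚ i ℚ.≤ (pOf c ^ℚ c) ℚ.* ((pOf c ^ℚ (c ∸ 1)) ℚ.- ℕ→ℚ 2) →
    ℕ→ℚ a ℚ.* ℕ→ℚ (c ∸ 1) ℚ.≤ pOf c ^ℚ c →
    DorAtMost a (a + i) (c ∸ 1)
theorem2 a i (suc c′@(suc (suc _))) 2≤a (s≤s (s≤s (s≤s _))) i-bound a-bound =
  -- the argument only needs c ≥ 3
  ¬Regular⇒DorAtMost {a} {a + i} λ regular →
    no-monochromatic-triple a i 2≤a (a-bound-cleared a c′ a-bound) (i-bound-cleared i c′ i-bound) (regular colour)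
  where open LogColouring c′ (s≤s (s≤s z≤n))
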